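{- Let $m\in\mathcal{U}$ and let $k$ be a positive integer. Then $mp^k\in\mathcal{U}$ for every prime $p$ compatible with $m$. In particular, $mp^k\in\mathcal{U}$ for every prime $p>g_m$.
   Context: $\mathcal{U}$ is the set of positive integers $N$ such that $\sum_{n=1}^{N-1} w_n/n \ne 1/N$ for all choices $w_1,\dots,w_{N-1}\in\{ -1,0,+1\}$. A prime $p$ is called compatible with a positive integer $m$ if $p$ does not divide the numerator (in lowest terms) of any rational number of the form $1/m - \sum_{j=1}^{m-1} w_j/j$ with $w_j\in\{ -1,0,+1\}$. For a positive integer $m$, $g_m := \operatorname{lcm}\{1,\dots,m\}\cdot\sum_{j=1}^m \frac1j$. -}

module Defs where

open import Data.Nat as ℕ using (ℕ; zero; suc; _≤_; _∸_)
open import Data.Nat.LCM using (lcm)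
open import Data.Nat.Divisibility using (_∣_)
open import Data.Integer as ℤ using (ℤ; +_)
open import Data.Rational using (ℚ; 0ℚ; _+_; _-_; _*_; -_; _/_; ↥_)
open import Relation.Binary.PropositionalEquality using (_≢_)

data Sign : Set where
  minus zer plus : Sign

signVal : Sign → ℚ
signVal minus = - (+ 1 / 1)
signVal zer   = 0ℚ
signVal plus  = + 1 / 1

-- recip n = 1/n for n ≥ 1 (recip 0 = 0, never used for 0 in the statement).
recip : ℕ → ℚ
recip zero    = 0ℚ
recip (suc n) = + 1 / suc n

wsum : ℕ → (ℕ → Sign) → ℚ
wsum zero    w = 0ℚ
wsum (suc M) w = wsum M w + signVal (w (suc M)) * recip (suc M)

InU : ℕ → Set
InU N = (1 ≤ N) × (∀ (w : ℕ → Sign) → wsum (N ∸ 1) w ≢ recip N)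
  where open import Data.Product using (_×_)

Compatible : ℕ → ℕ → Set
Compatible p m = ∀ (w : ℕ → Sign) → ¬ (p ∣ ℤ.∣ ↥ (recip m - wsum (m ∸ 1) w) ∣)
  where open import Relation.Nullary using (¬_)

lcmUpTo : ℕ → ℕ
lcmUpTo zero    = 1
lcmUpTo (suc m) = lcm (lcmUpTo m) (suc m)

harmonic : ℕ → ℚ
harmonic zero    = 0ℚ
harmonic (suc m) = harmonic m + recip (suc m)

-- g_m = lcm{1..m} · H_m  (as a rational; it is an integer)
g : ℕ → ℚ
g m = (+ lcmUpTo m / 1) * harmonic m

module Submission where

-- Let K = p ^ k and suppose Σ_{n < mK} w_n / n = 1 / (mK).  Multiply by K:
-- a term K w_n / n with K ∤ n has positive p-adic valuation (v_p(n) < k), while the terms with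
-- n = jK contribute w_{jK} / j.  So 1/m − Σ_{j<m} w_{jK} / j is a sum of fractions p a / b with
-- p ∤ b, and p divides its numerator, which compatibility forbids.
--
-- For x = 1/m − Σ_{j<m} w_j / j the number Z = lcm{1,…,m} · x is an integer with
-- |Z| ≤ g_m < p, and Z ≠ 0 because m ∈ 𝒰.  As lcm{1,…,m} · num(x) = Z · den(x) and p ∤ den(x),
-- p ∣ num(x) would give p ∣ Z.

open import Defs
open import Data.Nat as ℕ using (ℕ; zero; suc; NonZero)
import Data.Nat.Properties as ℕₚ
open import Data.Nat.Base using (nonTrivial⇒≢1; ≢-nonZero)
open import Data.Nat.Divisibility
  using (_∣_; divides; _∣?_; _∣0; 1∣_; ∣1⇒≡1; ∣m⇒∣m*n; m∣m*n; n∣m*n; ∣m+n∣m⇒∣n; ∣⇒≤; ∣-trans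
        ; *-monoˡ-∣)
open import Data.Nat.GCD using (gcd)
open import Data.Nat.LCM using (m∣lcm[m,n]; n∣lcm[m,n]; gcd*lcm)
open import Data.Nat.Primality using (Prime; euclidsLemma; prime⇒nonTrivial; prime⇒nonZero)
open import Data.Nat.Coprimality using (recompute)
open import Data.Integer as ℤ using (ℤ; +_; -[1+_])
import Data.Integer.Properties as ℤ
open import Data.Integer.Tactic.RingSolver using (solve-∀)
open import Data.Rational.Unnormalised as ℚᵘ using (mkℚᵘ; *≡*)
import Data.Rational.Unnormalised.Properties as ℚᵘₚ
open import Data.Product using (_,_; proj₁; proj₂; ∃-syntax)
open import Data.Sum using (inj₁; inj₂; [_,_]′)
open import Function using (id; _∘_)
open import Relation.Nullary using (¬_; yes; no; contradiction)
open import Relation.Binary.PropositionalEquality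

module _ where
  open import Data.Rational
    using (ℚ; mkℚ; 0ℚ; 1ℚ; _+_; _*_; _-_; -_; _/_; ↥_; ↧ₙ_; ∣_∣; _≤_; _<_; fromℚᵘ; toℚᵘ)
  open import Data.Rational.Properties
  open import Data.Rational.Solver using (module +-*-Solver)
  open +-*-Solver

  fromℚᵘ-homo-+ : ∀ x y → fromℚᵘ (x ℚᵘ.+ y) ≡ fromℚᵘ x + fromℚᵘ y
  fromℚᵘ-homo-+ x y = toℚᵘ-injective (begin
    toℚᵘ (fromℚᵘ (x ℚᵘ.+ y))               ≈⟨ toℚᵘ-fromℚᵘ (x ℚᵘ.+ y) ⟩
    x ℚᵘ.+ y                               ≈⟨ ℚᵘₚ.+-cong (toℚᵘ-fromℚᵘ x) (toℚᵘ-fromℚᵘ y) ⟨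
    toℚᵘ (fromℚᵘ x) ℚᵘ.+ toℚᵘ (fromℚᵘ y)   ≈⟨ toℚᵘ-homo-+ (fromℚᵘ x) (fromℚᵘ y) ⟨
    toℚᵘ (fromℚᵘ x + fromℚᵘ y)             ∎)
    where open ℚᵘₚ.≃-Reasoning

  fromℚᵘ-homo-* : ∀ x y → fromℚᵘ (x ℚᵘ.* y) ≡ fromℚᵘ x * fromℚᵘ y
  fromℚᵘ-homo-* x y = toℚᵘ-injective (begin
    toℚᵘ (fromℚᵘ (x ℚᵘ.* y))               ≈⟨ toℚᵘ-fromℚᵘ (x ℚᵘ.* y) ⟩
    x ℚᵘ.* y                               ≈⟨ ℚᵘₚ.*-cong (toℚᵘ-fromℚᵘ x) (toℚᵘ-fromℚᵘ y) ⟨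
    toℚᵘ (fromℚᵘ x) ℚᵘ.* toℚᵘ (fromℚᵘ y)   ≈⟨ toℚᵘ-homo-* (fromℚᵘ x) (fromℚᵘ y) ⟨
    toℚᵘ (fromℚᵘ x * fromℚᵘ y)             ∎)
    where open ℚᵘₚ.≃-Reasoning

  fromℤ : ℤ → ℚ
  fromℤ z = z / 1

  fromℤ-homo-+ : ∀ a b → fromℤ (a ℤ.+ b) ≡ fromℤ a + fromℤ b
  fromℤ-homo-+ a b = trans (fromℚᵘ-cong {mkℚᵘ (a ℤ.+ b) 0} {mkℚᵘ a 0 ℚᵘ.+ mkℚᵘ b 0} (*≡* (eq a b)))
                           (fromℚᵘ-homo-+ (mkℚᵘ a 0) (mkℚᵘ b 0))
    where
    eq : ∀ a b → (a ℤ.+ b) ℤ.* + 1 ≡ (a ℤ.* + 1 ℤ.+ b ℤ.* + 1) ℤ.* + 1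
    eq = solve-∀

  fromℤ-homo-* : ∀ a b → fromℤ (a ℤ.* b) ≡ fromℤ a * fromℤ b
  fromℤ-homo-* a b = fromℚᵘ-homo-* (mkℚᵘ a 0) (mkℚᵘ b 0)

  fromℤ∘+-homo-* : ∀ m n → fromℤ (+ (m ℕ.* n)) ≡ fromℤ (+ m) * fromℤ (+ n)
  fromℤ∘+-homo-* m n = trans (cong fromℤ (ℤ.pos-* m n)) (fromℤ-homo-* (+ m) (+ n))

  fromℤ-homo‿- : ∀ a → fromℤ (ℤ.- a) ≡ - fromℤ a
  fromℤ-homo‿- a = toℚᵘ-injective (begin
    toℚᵘ (fromℤ (ℤ.- a))   ≈⟨ toℚᵘ-fromℚᵘ (mkℚᵘ (ℤ.- a) 0) ⟩
    mkℚᵘ (ℤ.- a) 0          ≈⟨ ℚᵘₚ.-‿cong (toℚᵘ-fromℚᵘ (mkℚᵘ a 0)) ⟨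
    ℚᵘ.- toℚᵘ (fromℤ a)    ≈⟨ toℚᵘ-homo‿- (fromℤ a) ⟨
    toℚᵘ (- fromℤ a)        ∎)
    where open ℚᵘₚ.≃-Reasoning

  fromℤ-mono-≤ : ∀ {a b} → a ℤ.≤ b → fromℤ a ≤ fromℤ b
  fromℤ-mono-≤ {a} {b} a≤b = toℚᵘ-cancel-≤
    (ℚᵘₚ.≤-respˡ-≃ (ℚᵘₚ.≃-sym (toℚᵘ-fromℚᵘ (mkℚᵘ a 0)))
      (ℚᵘₚ.≤-respʳ-≃ (ℚᵘₚ.≃-sym (toℚᵘ-fromℚᵘ (mkℚᵘ b 0)))
        (ℚᵘ.*≤* (ℤ.*-monoʳ-≤-nonNeg (+ 1) a≤b))))

  0≤fromℤ[+n] : ∀ n → 0ℚ ≤ fromℤ (+ n)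
  0≤fromℤ[+n] n = nonNegative⁻¹ (fromℤ (+ n)) {{normalize-nonNeg n 1}}

  ∣fromℤ∣ : ∀ z → ∣ fromℤ z ∣ ≡ fromℤ (+ ℤ.∣ z ∣)
  ∣fromℤ∣ (+ n)    = 0≤p⇒∣p∣≡p (0≤fromℤ[+n] n)
  ∣fromℤ∣ -[1+ n ] = begin
    ∣ fromℤ (ℤ.- + suc n) ∣   ≡⟨ cong ∣_∣ (fromℤ-homo‿- (+ suc n)) ⟩
    ∣ - fromℤ (+ suc n) ∣     ≡⟨ ∣-p∣≡∣p∣ (fromℤ (+ suc n)) ⟩
    ∣ fromℤ (+ suc n) ∣       ≡⟨ 0≤p⇒∣p∣≡p (0≤fromℤ[+n] (suc n)) ⟩
    fromℤ (+ suc n)           ∎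
    where open ≡-Reasoning

  recip-homo-* : ∀ m n → recip (m ℕ.* n) ≡ recip m * recip n
  recip-homo-* zero    n       = sym (*-zeroˡ (recip n))
  recip-homo-* (suc m) zero    = trans (cong recip (ℕₚ.*-zeroʳ m)) (sym (*-zeroʳ (recip (suc m))))
  recip-homo-* (suc m) (suc n) =
    trans (fromℚᵘ-cong {mkℚᵘ (+ 1) (n ℕ.+ m ℕ.* suc n)} {mkℚᵘ (+ 1) m ℚᵘ.* mkℚᵘ (+ 1) n}
                       (*≡* (cong (+ 1 ℤ.*_) (sym (ℤ.pos-* (suc m) (suc n))))))
          (fromℚᵘ-homo-* (mkℚᵘ (+ 1) m) (mkℚᵘ (+ 1) n))

  0≤recip : ∀ n → 0ℚ ≤ recip n
  0≤recip zero    = ≤-refl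
  0≤recip (suc n) = nonNegative⁻¹ (recip (suc n)) {{normalize-nonNeg 1 (suc n)}}

  fromℤ*recip≡1 : ∀ n .{{_ : NonZero n}} → fromℤ (+ n) * recip n ≡ 1ℚ
  fromℤ*recip≡1 (suc n) =
    trans (sym (fromℚᵘ-homo-* (mkℚᵘ (+ suc n) 0) (mkℚᵘ (+ 1) n)))
          (fromℚᵘ-cong {mkℚᵘ (+ suc n) 0 ℚᵘ.* mkℚᵘ (+ 1) n} {mkℚᵘ (+ 1) 0} (*≡* (eq (+ suc n))))
    where
    eq : ∀ a → a ℤ.* + 1 ℤ.* + 1 ≡ + 1 ℤ.* (+ 1 ℤ.* a)
    eq = solve-∀

  recip-*-cancelʳ : ∀ m n .{{_ : NonZero n}} → fromℤ (+ n) * recip (m ℕ.* n) ≡ recip m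
  recip-*-cancelʳ m n = begin
    fromℤ (+ n) * recip (m ℕ.* n)       ≡⟨ cong (fromℤ (+ n) *_) (recip-homo-* m n) ⟩
    fromℤ (+ n) * (recip m * recip n)   ≡⟨ solve 3 (λ a x y → a :* (x :* y) := x :* (a :* y)) refl
                                                 (fromℤ (+ n)) (recip m) (recip n) ⟩
    recip m * (fromℤ (+ n) * recip n)   ≡⟨ cong (recip m *_) (fromℤ*recip≡1 n) ⟩
    recip m * 1ℚ                        ≡⟨ *-identityʳ (recip m) ⟩
    recip m                             ∎
    where open ≡-Reasoning

  recip*fromℤ[c*n]≡fromℤ[c] : ∀ c n .{{_ : NonZero n}} → recip n * fromℤ (+ (c ℕ.* n)) ≡ fromℤ (+ c)
  recip*fromℤ[c*n]≡fromℤ[c] c n = begin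
    recip n * fromℤ (+ (c ℕ.* n))          ≡⟨ cong (recip n *_) (fromℤ∘+-homo-* c n) ⟩
    recip n * (fromℤ (+ c) * fromℤ (+ n))  ≡⟨ solve 3 (λ r a b → r :* (a :* b) := a :* (b :* r)) refl
                                                    (recip n) (fromℤ (+ c)) (fromℤ (+ n)) ⟩
    fromℤ (+ c) * (fromℤ (+ n) * recip n)  ≡⟨ cong (fromℤ (+ c) *_) (fromℤ*recip≡1 n) ⟩
    fromℤ (+ c) * 1ℚ                       ≡⟨ *-identityʳ (fromℤ (+ c)) ⟩
    fromℤ (+ c)                            ∎
    where open ≡-Reasoning

  signℤ : Sign → ℤ
  signℤ minus = -[1+ 0 ]
  signℤ zer   = + 0
  signℤ plus  = + 1

  signVal≡fromℤ∘signℤ : ∀ s → signVal s ≡ fromℤ (signℤ s)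
  signVal≡fromℤ∘signℤ minus = refl
  signVal≡fromℤ∘signℤ zer   = refl
  signVal≡fromℤ∘signℤ plus  = refl

  ∣signVal*r∣≤r : ∀ s {r} → 0ℚ ≤ r → ∣ signVal s * r ∣ ≤ r
  ∣signVal*r∣≤r minus {r} 0≤r = ≤-reflexive (begin
    ∣ - 1ℚ * r ∣     ≡⟨ cong ∣_∣ (neg-distribˡ-* 1ℚ r) ⟨
    ∣ - (1ℚ * r) ∣   ≡⟨ ∣-p∣≡∣p∣ (1ℚ * r) ⟩
    ∣ 1ℚ * r ∣       ≡⟨ cong ∣_∣ (*-identityˡ r) ⟩
    ∣ r ∣            ≡⟨ 0≤p⇒∣p∣≡p 0≤r ⟩
    r                ∎)
    where open ≡-Reasoning
  ∣signVal*r∣≤r zer   {r} 0≤r = subst (_≤ r) (cong ∣_∣ (sym (*-zeroˡ r))) 0≤r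
  ∣signVal*r∣≤r plus  {r} 0≤r = ≤-reflexive (trans (cong ∣_∣ (*-identityˡ r)) (0≤p⇒∣p∣≡p 0≤r))

  ∣wsum∣≤harmonic : ∀ M w → ∣ wsum M w ∣ ≤ harmonic M
  ∣wsum∣≤harmonic zero    w = ≤-refl
  ∣wsum∣≤harmonic (suc M) w =
    ≤-trans (∣p+q∣≤∣p∣+∣q∣ (wsum M w) (signVal (w (suc M)) * recip (suc M)))
            (+-mono-≤ (∣wsum∣≤harmonic M w) (∣signVal*r∣≤r (w (suc M)) (0≤recip (suc M))))

  ∣recip-wsum∣≤harmonic : ∀ m w → ∣ recip (suc m) - wsum m w ∣ ≤ harmonic (suc m)
  ∣recip-wsum∣≤harmonic m w = begin
    ∣ recip (suc m) - wsum m w ∣       ≤⟨ ∣p-q∣≤∣p∣+∣q∣ (recip (suc m)) (wsum m w) ⟩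
    ∣ recip (suc m) ∣ + ∣ wsum m w ∣   ≡⟨ cong (_+ ∣ wsum m w ∣) (0≤p⇒∣p∣≡p (0≤recip (suc m))) ⟩
    recip (suc m) + ∣ wsum m w ∣       ≤⟨ +-monoʳ-≤ (recip (suc m)) (∣wsum∣≤harmonic m w) ⟩
    recip (suc m) + harmonic m         ≡⟨ +-comm (recip (suc m)) (harmonic m) ⟩
    harmonic (suc m)                   ∎
    where open ≤-Reasoning

  ∣lcmUpTo : ∀ m n → n ℕ.< m → suc n ∣ lcmUpTo m
  ∣lcmUpTo (suc m) n (ℕ.s≤s n≤m) with ℕₚ.m≤n⇒m<n∨m≡n n≤m
  ... | inj₁ n<m  = ∣-trans (∣lcmUpTo m n n<m) (m∣lcm[m,n] (lcmUpTo m) (suc m))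
  ... | inj₂ refl = n∣lcm[m,n] (lcmUpTo n) (suc n)

  lcmUpTo≢0 : ∀ m → lcmUpTo m ≢ 0
  lcmUpTo≢0 zero    ()
  lcmUpTo≢0 (suc m) lcm≡0 with ℕₚ.m*n≡0⇒m≡0∨n≡0 (lcmUpTo m) {suc m} product≡0
    where
    product≡0 : lcmUpTo m ℕ.* suc m ≡ 0
    product≡0 = begin
      lcmUpTo m ℕ.* suc m                          ≡⟨ gcd*lcm (lcmUpTo m) (suc m) ⟨
      gcd (lcmUpTo m) (suc m) ℕ.* lcmUpTo (suc m)  ≡⟨ cong (gcd (lcmUpTo m) (suc m) ℕ.*_) lcm≡0 ⟩
      gcd (lcmUpTo m) (suc m) ℕ.* 0                ≡⟨ ℕₚ.*-zeroʳ (gcd (lcmUpTo m) (suc m)) ⟩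
      0                                            ∎
      where open ≡-Reasoning
  ... | inj₁ lcmUpTo≡0 = lcmUpTo≢0 m lcmUpTo≡0

  wsum*fromℤ-integral : ∀ D M w → (∀ n → n ℕ.< M → suc n ∣ D) →
                        ∃[ z ] wsum M w * fromℤ (+ D) ≡ fromℤ z
  wsum*fromℤ-integral D zero w _ = + 0 , *-zeroˡ (fromℤ (+ D))
  wsum*fromℤ-integral D (suc M) w ∣D
    with wsum*fromℤ-integral D M w (λ n n<M → ∣D n (ℕₚ.m<n⇒m<1+n n<M)) | ∣D M ℕₚ.≤-refl
  ... | z , S*d≡z | divides c D≡c*[1+M] = z ℤ.+ signℤ s ℤ.* + c , (begin
    (S + σ * ρ) * d
      ≡⟨ solve 4 (λ S σ ρ d → (S :+ σ :* ρ) :* d := S :* d :+ σ :* (ρ :* d)) refl S σ ρ d ⟩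
    S * d + σ * (ρ * d)
      ≡⟨ cong₂ (λ x y → x + σ * y) S*d≡z ρ*d≡c ⟩
    fromℤ z + σ * fromℤ (+ c)
      ≡⟨ cong (λ t → fromℤ z + t * fromℤ (+ c)) (signVal≡fromℤ∘signℤ s) ⟩
    fromℤ z + fromℤ (signℤ s) * fromℤ (+ c)
      ≡⟨ cong (λ t → fromℤ z + t) (fromℤ-homo-* (signℤ s) (+ c)) ⟨
    fromℤ z + fromℤ (signℤ s ℤ.* + c)
      ≡⟨ fromℤ-homo-+ z (signℤ s ℤ.* + c) ⟨
    fromℤ (z ℤ.+ signℤ s ℤ.* + c)
      ∎)
    where
    open ≡-Reasoning
    s = w (suc M)
    σ = signVal s
    S = wsum M w
    ρ = recip (suc M)
    d = fromℤ (+ D)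
    ρ*d≡c : ρ * d ≡ fromℤ (+ c)
    ρ*d≡c = trans (cong (λ t → ρ * fromℤ (+ t)) D≡c*[1+M]) (recip*fromℤ[c*n]≡fromℤ[c] c (suc M))

  recip-wsum*lcm-integral : ∀ m w → ∃[ Z ] (recip (suc m) - wsum m w) * fromℤ (+ lcmUpTo (suc m)) ≡ fromℤ Z
  recip-wsum*lcm-integral m w
    with wsum*fromℤ-integral (lcmUpTo (suc m)) m w (λ n n<m → ∣lcmUpTo (suc m) n (ℕₚ.m<n⇒m<1+n n<m))
       | ∣lcmUpTo (suc m) m ℕₚ.≤-refl
  ... | z , S*d≡z | divides c L≡c*[1+m] = + c ℤ.- z , (begin
    (ρ - S) * d                   ≡⟨ solve 3 (λ ρ S d → (ρ :- S) :* d := ρ :* d :- S :* d) refl ρ S d ⟩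
    ρ * d - S * d                 ≡⟨ cong₂ _-_ ρ*d≡c S*d≡z ⟩
    fromℤ (+ c) - fromℤ z         ≡⟨ cong (λ t → fromℤ (+ c) + t) (fromℤ-homo‿- z) ⟨
    fromℤ (+ c) + fromℤ (ℤ.- z)   ≡⟨ fromℤ-homo-+ (+ c) (ℤ.- z) ⟨
    fromℤ (+ c ℤ.- z)             ∎)
    where
    open ≡-Reasoning
    ρ = recip (suc m)
    S = wsum m w
    d = fromℤ (+ lcmUpTo (suc m))
    ρ*d≡c : ρ * d ≡ fromℤ (+ c)
    ρ*d≡c = trans (cong (λ t → ρ * fromℤ (+ t)) L≡c*[1+m]) (recip*fromℤ[c*n]≡fromℤ[c] c (suc m))

  q*b≡c⇒∣↥q∣*∣b∣≡∣c∣*↧q : ∀ q b c → q * fromℤ b ≡ fromℤ c →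
                          ℤ.∣ ↥ q ∣ ℕ.* ℤ.∣ b ∣ ≡ ℤ.∣ c ∣ ℕ.* ↧ₙ q
  q*b≡c⇒∣↥q∣*∣b∣≡∣c∣*↧q q@(mkℚ n d _) b c q*b≡c with toℚᵘ-q*b≃c
    where
    toℚᵘ-q*b≃c : mkℚᵘ n d ℚᵘ.* mkℚᵘ b 0 ℚᵘ.≃ mkℚᵘ c 0
    toℚᵘ-q*b≃c = begin
      mkℚᵘ n d ℚᵘ.* mkℚᵘ b 0        ≈⟨ ℚᵘₚ.*-cong (ℚᵘₚ.≃-refl {mkℚᵘ n d}) (toℚᵘ-fromℚᵘ (mkℚᵘ b 0)) ⟨
      toℚᵘ q ℚᵘ.* toℚᵘ (fromℤ b)    ≈⟨ ℚᵘₚ.≃-sym (toℚᵘ-homo-* q (fromℤ b)) ⟩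
      toℚᵘ (q * fromℤ b)            ≈⟨ toℚᵘ-cong q*b≡c ⟩
      toℚᵘ (fromℤ c)                ≈⟨ toℚᵘ-fromℚᵘ (mkℚᵘ c 0) ⟩
      mkℚᵘ c 0                      ∎
      where open ℚᵘₚ.≃-Reasoning
  ... | *≡* nb≡c[1+d] = begin
    ℤ.∣ n ∣ ℕ.* ℤ.∣ b ∣             ≡⟨ ℤ.abs-* n b ⟨
    ℤ.∣ n ℤ.* b ∣                   ≡⟨ cong ℤ.∣_∣ (trans (sym (ℤ.*-identityʳ (n ℤ.* b))) nb≡c[1+d]) ⟩
    ℤ.∣ c ℤ.* (+ suc d ℤ.* + 1) ∣   ≡⟨ cong (λ t → ℤ.∣ c ℤ.* t ∣) (ℤ.*-identityʳ (+ suc d)) ⟩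
    ℤ.∣ c ℤ.* + suc d ∣             ≡⟨ ℤ.abs-* c (+ suc d) ⟩
    ℤ.∣ c ∣ ℕ.* suc d               ∎
    where open ≡-Reasoning

  q*b≡c⇒fromℤ∣c∣≡∣q∣*fromℤ∣b∣ : ∀ q b c → q * fromℤ b ≡ fromℤ c →
                                fromℤ (+ ℤ.∣ c ∣) ≡ ∣ q ∣ * fromℤ (+ ℤ.∣ b ∣)
  q*b≡c⇒fromℤ∣c∣≡∣q∣*fromℤ∣b∣ q b c q*b≡c = begin
    fromℤ (+ ℤ.∣ c ∣)           ≡⟨ ∣fromℤ∣ c ⟨
    ∣ fromℤ c ∣                 ≡⟨ cong ∣_∣ q*b≡c ⟨
    ∣ q * fromℤ b ∣             ≡⟨ ∣p*q∣≡∣p∣*∣q∣ q (fromℤ b) ⟩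
    ∣ q ∣ * ∣ fromℤ b ∣         ≡⟨ cong (∣ q ∣ *_) (∣fromℤ∣ b) ⟩
    ∣ q ∣ * fromℤ (+ ℤ.∣ b ∣)   ∎
    where open ≡-Reasoning

  q*b≡c⇒∣c∣≡0⇒q≡0 : ∀ q b c → q * fromℤ b ≡ fromℤ c → ℤ.∣ b ∣ ≢ 0 → ℤ.∣ c ∣ ≡ 0 → q ≡ 0ℚ
  q*b≡c⇒∣c∣≡0⇒q≡0 q b c q*b≡c ∣b∣≢0 ∣c∣≡0
    with ℕₚ.m*n≡0⇒m≡0∨n≡0 ℤ.∣ ↥ q ∣
           (trans (q*b≡c⇒∣↥q∣*∣b∣≡∣c∣*↧q q b c q*b≡c) (cong (ℕ._* ↧ₙ q) ∣c∣≡0))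
  ... | inj₁ ∣↥q∣≡0 = ↥p≡0⇒p≡0 q (ℤ.∣i∣≡0⇒i≡0 ∣↥q∣≡0)
  ... | inj₂ ∣b∣≡0  = contradiction ∣b∣≡0 ∣b∣≢0

  -- p ∣ℚ q says that q = p · num / den with p ∤ den, i.e. q has positive p-adic valuation.
  record _∣ℚ_ (p : ℕ) (q : ℚ) : Set where
    constructor dividesℚ
    field
      num      : ℤ
      den      : ℕ
      p∤den    : ¬ p ∣ den
      equality : q * fromℤ (+ den) ≡ fromℤ (+ p ℤ.* num)

  module _ {p : ℕ} (p-prime : Prime p) where

    private
      p≢1 : p ≢ 1
      p≢1 = nonTrivial⇒≢1 {{prime⇒nonTrivial p-prime}}

    ∣ℚ-0 : p ∣ℚ 0ℚ
    ∣ℚ-0 = dividesℚ (+ 0) 1 (p≢1 ∘ ∣1⇒≡1) (cong fromℤ (sym (ℤ.*-zeroʳ (+ p))))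

    ∣ℚ-+ : ∀ {q r} → p ∣ℚ q → p ∣ℚ r → p ∣ℚ (q + r)
    ∣ℚ-+ {q} {r} (dividesℚ a b p∤b qb≡pa) (dividesℚ c d p∤d rd≡pc) =
      dividesℚ (a ℤ.* + d ℤ.+ c ℤ.* + b) (b ℕ.* d) p∤bd (begin
        (q + r) * fromℤ (+ (b ℕ.* d))
          ≡⟨ cong ((q + r) *_) (fromℤ∘+-homo-* b d) ⟩
        (q + r) * (B * D)
          ≡⟨ solve 4 (λ q r B D → (q :+ r) :* (B :* D) := (q :* B) :* D :+ (r :* D) :* B) refl q r B D ⟩
        (q * B) * D + (r * D) * B
          ≡⟨ cong₂ (λ x y → x * D + y * B) qb≡pa rd≡pc ⟩
        fromℤ (+ p ℤ.* a) * D + fromℤ (+ p ℤ.* c) * B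
          ≡⟨ cong₂ _+_ (fromℤ-homo-* (+ p ℤ.* a) (+ d)) (fromℤ-homo-* (+ p ℤ.* c) (+ b)) ⟨
        fromℤ (+ p ℤ.* a ℤ.* + d) + fromℤ (+ p ℤ.* c ℤ.* + b)
          ≡⟨ fromℤ-homo-+ (+ p ℤ.* a ℤ.* + d) (+ p ℤ.* c ℤ.* + b) ⟨
        fromℤ (+ p ℤ.* a ℤ.* + d ℤ.+ + p ℤ.* c ℤ.* + b)
          ≡⟨ cong fromℤ (distrib (+ p) a c (+ b) (+ d)) ⟩
        fromℤ (+ p ℤ.* (a ℤ.* + d ℤ.+ c ℤ.* + b))
          ∎)
      where
      open ≡-Reasoning
      B = fromℤ (+ b)
      D = fromℤ (+ d)
      p∤bd : ¬ p ∣ b ℕ.* d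
      p∤bd p∣bd = [ p∤b , p∤d ]′ (euclidsLemma b d p-prime p∣bd)
      distrib : ∀ p a c b d → p ℤ.* a ℤ.* d ℤ.+ p ℤ.* c ℤ.* b ≡ p ℤ.* (a ℤ.* d ℤ.+ c ℤ.* b)
      distrib = solve-∀

    ∣ℚ-fromℤ* : ∀ z {q} → p ∣ℚ q → p ∣ℚ (fromℤ z * q)
    ∣ℚ-fromℤ* z {q} (dividesℚ a b p∤b qb≡pa) = dividesℚ (z ℤ.* a) b p∤b (begin
      fromℤ z * q * fromℤ (+ b)     ≡⟨ *-assoc (fromℤ z) q (fromℤ (+ b)) ⟩
      fromℤ z * (q * fromℤ (+ b))   ≡⟨ cong (fromℤ z *_) qb≡pa ⟩
      fromℤ z * fromℤ (+ p ℤ.* a)   ≡⟨ fromℤ-homo-* z (+ p ℤ.* a) ⟨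
      fromℤ (z ℤ.* (+ p ℤ.* a))     ≡⟨ cong fromℤ (swap z (+ p) a) ⟩
      fromℤ (+ p ℤ.* (z ℤ.* a))     ∎)
      where
      open ≡-Reasoning
      swap : ∀ z p a → z ℤ.* (p ℤ.* a) ≡ p ℤ.* (z ℤ.* a)
      swap = solve-∀

    ∣ℚ⇒∣↥ : ∀ {q} → p ∣ℚ q → p ∣ ℤ.∣ ↥ q ∣
    ∣ℚ⇒∣↥ {q} (dividesℚ a b p∤b qb≡pa) =
      [ id , (λ p∣b → contradiction p∣b p∤b) ]′ (euclidsLemma ℤ.∣ ↥ q ∣ b p-prime p∣↥q*b)
      where
      p∣pa*↧q : p ∣ ℤ.∣ + p ℤ.* a ∣ ℕ.* ↧ₙ q
      p∣pa*↧q = ∣m⇒∣m*n (↧ₙ q) (subst (p ∣_) (sym (ℤ.abs-* (+ p) a)) (m∣m*n ℤ.∣ a ∣))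
      p∣↥q*b : p ∣ ℤ.∣ ↥ q ∣ ℕ.* b
      p∣↥q*b = subst (p ∣_) (sym (q*b≡c⇒∣↥q∣*∣b∣≡∣c∣*↧q q (+ b) (+ p ℤ.* a) qb≡pa)) p∣pa*↧q

    ∣ℚ-p^k*recip : ∀ k n → ¬ p ℕ.^ k ∣ n → p ∣ℚ (fromℤ (+ (p ℕ.^ k)) * recip n)
    ∣ℚ-p^k*recip zero    n p^0∤n = contradiction (1∣ n) p^0∤n
    ∣ℚ-p^k*recip (suc k) n p^k+1∤n with p ∣? n
    ... | yes (divides q refl) = subst (p ∣ℚ_) (sym p^k+1/qp≡p^k/q) (∣ℚ-p^k*recip k q p^k∤q)
      where
      instance _ = prime⇒nonZero p-prime
      p^k∤q : ¬ p ℕ.^ k ∣ q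
      p^k∤q p^k∣q = p^k+1∤n (subst (_∣ q ℕ.* p) (ℕₚ.*-comm (p ℕ.^ k) p) (*-monoˡ-∣ p p^k∣q))
      P = fromℤ (+ p)
      Pᵏ = fromℤ (+ (p ℕ.^ k))
      p^k+1/qp≡p^k/q : fromℤ (+ (p ℕ.^ suc k)) * recip (q ℕ.* p) ≡ Pᵏ * recip q
      p^k+1/qp≡p^k/q = begin
        fromℤ (+ (p ℕ.* p ℕ.^ k)) * recip (q ℕ.* p)
          ≡⟨ cong (_* recip (q ℕ.* p)) (fromℤ∘+-homo-* p (p ℕ.^ k)) ⟩
        P * Pᵏ * recip (q ℕ.* p)
          ≡⟨ solve 3 (λ x y r → x :* y :* r := y :* (x :* r)) refl P Pᵏ (recip (q ℕ.* p)) ⟩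
        Pᵏ * (P * recip (q ℕ.* p))
          ≡⟨ cong (Pᵏ *_) (recip-*-cancelʳ q p) ⟩
        Pᵏ * recip q
          ∎
        where open ≡-Reasoning
    ... | no p∤n = dividesℚ (+ (p ℕ.^ k)) n p∤n (begin
        Pᵏ⁺¹ * recip n * fromℤ (+ n)
          ≡⟨ solve 3 (λ x r y → x :* r :* y := x :* (y :* r)) refl Pᵏ⁺¹ (recip n) (fromℤ (+ n)) ⟩
        Pᵏ⁺¹ * (fromℤ (+ n) * recip n)   ≡⟨ cong (Pᵏ⁺¹ *_) (fromℤ*recip≡1 n) ⟩
        Pᵏ⁺¹ * 1ℚ                        ≡⟨ *-identityʳ Pᵏ⁺¹ ⟩
        fromℤ (+ (p ℕ.* p ℕ.^ k))        ≡⟨ cong fromℤ (ℤ.pos-* p (p ℕ.^ k)) ⟩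
        fromℤ (+ p ℤ.* + (p ℕ.^ k))      ∎)
      where
      open ≡-Reasoning
      Pᵏ⁺¹ = fromℤ (+ (p ℕ.^ suc k))
      instance
        _ : NonZero n
        _ = ≢-nonZero (λ n≡0 → p∤n (subst (p ∣_) (sym n≡0) (p ∣0)))

    -- In defect j r the terms K w_n / n with K ∤ n are p-divisible, and each term with n = iK
    -- cancels against w_{iK} / i in the second sum.
    module MultiplesOf (K′ : ℕ) (w : ℕ → Sign)
                       (∣ℚ-K*recip : ∀ n → ¬ suc K′ ∣ n → p ∣ℚ (fromℤ (+ suc K′) * recip n)) where

      private
        K : ℕ
        K = suc K′
        k : ℚ
        k = fromℤ (+ K)

      wᴷ : ℕ → Sign
      wᴷ j = w (j ℕ.* K)

      defect : ℕ → ℕ → ℚ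
      defect j r = k * wsum (r ℕ.+ j ℕ.* K) w - wsum j wᴷ

      defect-suc : ∀ j r → defect j (suc r) ≡
                   defect j r + fromℤ (signℤ (w (suc r ℕ.+ j ℕ.* K))) * (k * recip (suc r ℕ.+ j ℕ.* K))
      defect-suc j r = begin
        k * (A + σ * ρ) - B
          ≡⟨ solve 5 (λ k A B σ ρ → k :* (A :+ σ :* ρ) :- B := (k :* A :- B) :+ σ :* (k :* ρ)) refl k A B σ ρ ⟩
        (k * A - B) + σ * (k * ρ)
          ≡⟨ cong (λ t → (k * A - B) + t * (k * ρ)) (signVal≡fromℤ∘signℤ s) ⟩
        (k * A - B) + fromℤ (signℤ s) * (k * ρ)
          ∎
        where
        open ≡-Reasoning
        s = w (suc r ℕ.+ j ℕ.* K)
        σ = signVal s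
        A = wsum (r ℕ.+ j ℕ.* K) w
        B = wsum j wᴷ
        ρ = recip (suc r ℕ.+ j ℕ.* K)

      defect-next-block : ∀ j → defect (suc j) 0 ≡ defect j K′
      defect-next-block j = begin
        k * (A + σ * ρ) - (B + σ * ρ′)
          ≡⟨ solve 6 (λ k A B σ ρ ρ′ → k :* (A :+ σ :* ρ) :- (B :+ σ :* ρ′)
                                       := (k :* A :- B) :+ σ :* (k :* ρ :- ρ′)) refl k A B σ ρ ρ′ ⟩
        (k * A - B) + σ * (k * ρ - ρ′)
          ≡⟨ cong (λ t → (k * A - B) + σ * (t - ρ′)) (recip-*-cancelʳ (suc j) K) ⟩
        (k * A - B) + σ * (ρ′ - ρ′)      ≡⟨ cong (λ t → (k * A - B) + σ * t) (+-inverseʳ ρ′) ⟩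
        (k * A - B) + σ * 0ℚ             ≡⟨ cong (λ t → (k * A - B) + t) (*-zeroʳ σ) ⟩
        (k * A - B) + 0ℚ                 ≡⟨ +-identityʳ (k * A - B) ⟩
        k * A - B                        ∎
        where
        open ≡-Reasoning
        σ = signVal (w (suc j ℕ.* K))
        A = wsum (K′ ℕ.+ j ℕ.* K) w
        B = wsum j wᴷ
        ρ = recip (suc j ℕ.* K)
        ρ′ = recip (suc j)

      defect-∣ℚ : ∀ j r → r ℕ.< K → p ∣ℚ defect j r
      defect-∣ℚ zero    zero    _   = subst (p ∣ℚ_) (sym (cong (_- 0ℚ) (*-zeroʳ k))) ∣ℚ-0
      defect-∣ℚ (suc j) zero    _   = subst (p ∣ℚ_) (sym (defect-next-block j)) (defect-∣ℚ j K′ ℕₚ.≤-refl)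
      defect-∣ℚ j       (suc r) r<K = subst (p ∣ℚ_) (sym (defect-suc j r))
        (∣ℚ-+ (defect-∣ℚ j r (ℕₚ.<-trans (ℕₚ.n<1+n r) r<K))
              (∣ℚ-fromℤ* (signℤ (w n)) (∣ℚ-K*recip n K∤n)))
        where
        n = suc r ℕ.+ j ℕ.* K
        K∤n : ¬ K ∣ n
        K∤n K∣n = ℕₚ.<⇒≱ r<K (∣⇒≤ (∣m+n∣m⇒∣n K∣jK+1+r (n∣m*n j)))
          where
          K∣jK+1+r : K ∣ j ℕ.* K ℕ.+ suc r
          K∣jK+1+r = subst (K ∣_) (ℕₚ.+-comm (suc r) (j ℕ.* K)) K∣n

    -- Compatible p 0 fails outright (the rational in question is 0), so no hypothesis m ≥ 1 is needed.
    compatible⇒InU-* : ∀ {m} → Compatible p m → ∀ K .{{_ : NonZero K}} →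
                       (∀ n → ¬ K ∣ n → p ∣ℚ (fromℤ (+ K) * recip n)) → InU (m ℕ.* K)
    compatible⇒InU-* {zero}  compat K        _          = contradiction (p ∣0) (compat (λ _ → zer))
    compatible⇒InU-* {suc m} compat (suc K′) ∣ℚ-K*recip = ℕ.s≤s ℕ.z≤n , sum≢recip
      where
      sum≢recip : ∀ w → wsum (K′ ℕ.+ m ℕ.* suc K′) w ≢ recip (suc m ℕ.* suc K′)
      sum≢recip w sum≡recip = compat wᴷ (∣ℚ⇒∣↥ (subst (p ∣ℚ_) defect≡ (defect-∣ℚ m K′ ℕₚ.≤-refl)))
        where
        open MultiplesOf K′ w ∣ℚ-K*recip
        defect≡ : defect m K′ ≡ recip (suc m) - wsum m wᴷ
        defect≡ = trans (cong (λ t → fromℤ (+ suc K′) * t - wsum m wᴷ) sum≡recip)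
                        (cong (_- wsum m wᴷ) (recip-*-cancelʳ (suc m) (suc K′)))

    compatible⇒InU-*p^k : ∀ {m} → Compatible p m → ∀ k → InU (m ℕ.* p ℕ.^ k)
    compatible⇒InU-*p^k {m} compat k =
      compatible⇒InU-* {m} compat (p ℕ.^ k) {{ℕₚ.m^n≢0 p k {{prime⇒nonZero p-prime}}}} (∣ℚ-p^k*recip k)

    ∣↥q∣⇒∣c : ∀ q b c → q * fromℤ b ≡ fromℤ c → p ∣ ℤ.∣ ↥ q ∣ → p ∣ ℤ.∣ c ∣
    ∣↥q∣⇒∣c q@(mkℚ _ _ coprime) b c q*b≡c p∣↥q =
      [ id , (λ p∣↧q → contradiction (recompute coprime (p∣↥q , p∣↧q)) p≢1) ]′
        (euclidsLemma ℤ.∣ c ∣ (↧ₙ q) p-prime p∣c*↧q)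
      where
      p∣c*↧q : p ∣ ℤ.∣ c ∣ ℕ.* ↧ₙ q
      p∣c*↧q = subst (p ∣_) (q*b≡c⇒∣↥q∣*∣b∣≡∣c∣*↧q q b c q*b≡c) (∣m⇒∣m*n ℤ.∣ b ∣ p∣↥q)

    p∤↥q : ∀ q L Z → q * fromℤ (+ L) ≡ fromℤ Z → L ≢ 0 → q ≢ 0ℚ → ∣ q ∣ * fromℤ (+ L) < fromℤ (+ p) →
           ¬ p ∣ ℤ.∣ ↥ q ∣
    p∤↥q q L Z q*L≡Z L≢0 q≢0 ∣q∣*L<p p∣↥q = <-irrefl refl (≤-<-trans p≤∣q∣*L ∣q∣*L<p)
      where
      ∣Z∣≢0 : ℤ.∣ Z ∣ ≢ 0
      ∣Z∣≢0 = q≢0 ∘ q*b≡c⇒∣c∣≡0⇒q≡0 q (+ L) Z q*L≡Z L≢0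
      p≤∣Z∣ : p ℕ.≤ ℤ.∣ Z ∣
      p≤∣Z∣ = ∣⇒≤ {{≢-nonZero ∣Z∣≢0}} (∣↥q∣⇒∣c q (+ L) Z q*L≡Z p∣↥q)
      p≤∣q∣*L : fromℤ (+ p) ≤ ∣ q ∣ * fromℤ (+ L)
      p≤∣q∣*L = begin
        fromℤ (+ p)           ≤⟨ fromℤ-mono-≤ (ℤ.+≤+ p≤∣Z∣) ⟩
        fromℤ (+ ℤ.∣ Z ∣)     ≡⟨ q*b≡c⇒fromℤ∣c∣≡∣q∣*fromℤ∣b∣ q (+ L) Z q*L≡Z ⟩
        ∣ q ∣ * fromℤ (+ L)   ∎
        where open ≤-Reasoning

    g<p⇒compatible : ∀ {m} → InU m → g m < fromℤ (+ p) → Compatible p m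
    g<p⇒compatible {zero}  (() , _)
    g<p⇒compatible {suc m} (_ , m∈U) g<p w =
      p∤↥q x L (proj₁ x*L-integral) (proj₂ x*L-integral) (lcmUpTo≢0 (suc m)) x≢0 (≤-<-trans ∣x∣*L≤g g<p)
      where
      x*L-integral = recip-wsum*lcm-integral m w
      x = recip (suc m) - wsum m w
      L = lcmUpTo (suc m)
      x≢0 : x ≢ 0ℚ
      x≢0 x≡0 = m∈U w (begin
        wsum m w             ≡⟨ solve 2 (λ ρ S → S := ρ :- (ρ :- S)) refl (recip (suc m)) (wsum m w) ⟩
        recip (suc m) - x    ≡⟨ cong (λ t → recip (suc m) - t) x≡0 ⟩
        recip (suc m) - 0ℚ   ≡⟨ +-identityʳ (recip (suc m)) ⟩
        recip (suc m)        ∎)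
        where open ≡-Reasoning
      ∣x∣*L≤g : ∣ x ∣ * fromℤ (+ L) ≤ g (suc m)
      ∣x∣*L≤g = begin
        ∣ x ∣ * fromℤ (+ L)
          ≤⟨ *-monoʳ-≤-nonNeg (fromℤ (+ L)) {{normalize-nonNeg L 1}} (∣recip-wsum∣≤harmonic m w) ⟩
        harmonic (suc m) * fromℤ (+ L)
          ≡⟨ *-comm (harmonic (suc m)) (fromℤ (+ L)) ⟩
        g (suc m)
          ∎
        where open ≤-Reasoning

open import Data.Nat using (_*_; _^_; _≤_)
open import Data.Rational using (_<_; _/_)
open import Data.Product using (_×_)

lemma4 : ∀ (m k : ℕ) → InU m → 1 ≤ k →
           (∀ (p : ℕ) → Prime p → Compatible p m → InU (m * p ^ k))
           × (∀ (p : ℕ) → Prime p → g m < (+ p / 1) → InU (m * p ^ k))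
lemma4 m k m∈U _ =
    (λ p p-prime compat → compatible⇒InU-*p^k p-prime {m} compat k)
  , (λ p p-prime g<p → compatible⇒InU-*p^k p-prime {m} (g<p⇒compatible p-prime m∈U g<p) k)
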